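{- Every finite group whose order is divisible by neither $2$ nor $3$ is colourable.
   Context: A bijection $\sigma\colon G\to G$ is a colouring bijection if the maps $x\mapsto\sigma(x)x$, $x\mapsto x^{ -1}\sigma(x)$, $x\mapsto x^{ -1}\sigma(x)x$ are all bijections of $G$; $G$ is colourable if it admits a colouring bijection. -}

module Defs where

open import Level using (Level; _⊔_)
open import Data.Nat using (ℕ)
open import Data.Fin using (Fin)
open import Data.Product using (_×_; Σ-syntax)
open import Algebra.Bundles using (Group)
open import Function.Definitions using (Congruent; Bijective)
open import Function.Bundles using (Bijection)
import Relation.Binary.PropositionalEquality as P

module _ {c ℓ : Level} (G : Group c ℓ) where
  open Group G

  IsBijectionOfG : (Carrier → Carrier) → Set (c ⊔ ℓ)
  IsBijectionOfG f = Congruent _≈_ _≈_ f × Bijective _≈_ _≈_ f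

  IsColouringBijection : (Carrier → Carrier) → Set (c ⊔ ℓ)
  IsColouringBijection σ =
    IsBijectionOfG σ
    × IsBijectionOfG (λ x → σ x ∙ x)
    × IsBijectionOfG (λ x → x ⁻¹ ∙ σ x)
    × IsBijectionOfG (λ x → (x ⁻¹ ∙ σ x) ∙ x)

  Colourable : Set (c ⊔ ℓ)
  Colourable = Σ[ σ ∈ (Carrier → Carrier) ] IsColouringBijection σ

  HasOrder : ℕ → Set (c ⊔ ℓ)
  HasOrder n = Bijection (P.setoid (Fin n)) setoid

-- Take σ x = x²: the four maps of the definition become x ↦ x², x ↦ x³, x ↦ x
-- and x ↦ x².  If k is coprime to n = |G| then x ↦ xᵏ is a bijection, because
-- Bézout gives e with (xᵏ)ᵉ = x as soon as xⁿ = ε for every x.  That is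
-- Lagrange's theorem for ⟨x⟩, proved by counting: the total of an x-invariant
-- weight on G is divisible by the order m of x, since the indicator of an orbit
-- {xᵏ h | k < m}, whose m points are distinct, can be subtracted from any
-- invariant weight that is positive at h.
module Submission where

open import Defs
open import Level using (Level; _⊔_)
open import Data.Nat using (ℕ)
open import Data.Nat.Divisibility using (_∣_)
open import Relation.Nullary using (¬_)
open import Algebra.Bundles using (Group)

open import Data.Fin using (Fin; zero; suc; toℕ; fromℕ; fromℕ<; inject₁; punchIn)
open import Data.Fin.Properties
  using (any?; pigeonhole; inj⇒≟; toℕ-injective; toℕ<n; toℕ-fromℕ<; toℕ-inject₁; toℕ-fromℕ; punchInᵢ≢i)
open import Data.Nat using (zero; suc; _+_; _*_; _∸_; _≤_; _<_; _<?_; _≟_; z≤n; z<s)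
open import Data.Nat.Coprimality using (Coprime; coprime-Bézout)
open import Data.Nat.Divisibility using (divides; ∣-refl; _∣0; ∣m∣n⇒∣m+n)
open import Data.Nat.GCD using (module Bézout)
open import Data.Nat.Induction using (<-wellFounded)
open import Data.Nat.Primality using (Prime; prime[2]; prime?; prime⇒irreducible)
open import Data.Nat.Properties
  using (+-comm; *-comm; *-assoc; +-0-commutativeMonoid; <-cmp; <⇒≤; ≤-<-trans; n<1+n; m<m+n;
         m∸n≤m; m<n⇒0<n∸m; m+[n∸m]≡n; m∸n+n≡m; n≢0⇒n>0; module ≤-Reasoning)
open import Data.Product using (∃; _×_; _,_; proj₁; proj₂; map)
open import Data.Sum using (inj₁; inj₂)
open import Function using (_∘_; id)
open import Function.Bundles using (Bijection; Injection)
open import Function.Properties.Bijection using (Bijection⇒Inverse)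
open import Function.Properties.Inverse using (Inverse⇒Injection) renaming (sym to ↔-sym)
open import Induction.WellFounded using (Acc; acc)
open import Relation.Binary using (tri<; tri≈; tri>)
open import Relation.Binary.PropositionalEquality as ≡ using (_≡_; _≢_; module ≡-Reasoning)
open import Relation.Nullary using (Dec; yes; no; contradiction)
open import Relation.Nullary.Decidable using (from-yes; _×-dec_)
open import Relation.Unary using (Pred; Decidable)
open import Algebra.Properties.CommutativeMonoid.Sum +-0-commutativeMonoid
  using (sum-syntax; sum-cong-≗; sum-replicate-zero; sum-remove; sum-init-last; ∑-comm; ∑-distrib-+)

∑-zero : ∀ {n} (f : Fin n → ℕ) → (∀ i → f i ≡ 0) → ∑[ i < n ] f i ≡ 0
∑-zero {n} f f≡0 = ≡.trans (sum-cong-≗ f≡0) (sum-replicate-zero n)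

∑-ones : ∀ n → ∑[ i < n ] 1 ≡ n
∑-ones zero    = ≡.refl
∑-ones (suc n) = ≡.cong suc (∑-ones n)

∑-indicator : ∀ {n} (f : Fin n → ℕ) a → f a ≡ 1 → (∀ i → i ≢ a → f i ≡ 0) → ∑[ i < n ] f i ≡ 1
∑-indicator {suc n} f a fa≡1 f≡0 = ≡.trans (sum-remove {i = a} f)
  (≡.cong₂ _+_ fa≡1 (∑-zero _ (λ j → f≡0 (punchIn a j) (punchInᵢ≢i a j))))

∑-nonzero : ∀ {n} (f : Fin n → ℕ) → ∑[ i < n ] f i ≢ 0 → ∃ λ i → f i ≢ 0
∑-nonzero {zero}  f ∑f≢0 = contradiction ≡.refl ∑f≢0
∑-nonzero {suc n} f ∑f≢0 with f zero ≟ 0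
... | no  f₀≢0 = zero , f₀≢0
... | yes f₀≡0 = map suc id (∑-nonzero (f ∘ suc) (∑f≢0 ∘ ≡.cong₂ _+_ f₀≡0))

∑-last : ∀ m (f : ℕ → ℕ) → ∑[ i < suc m ] f (toℕ i) ≡ f m + ∑[ i < m ] f (toℕ i)
∑-last m f = begin
  ∑[ i < suc m ] f (toℕ i)                          ≡⟨ sum-init-last (f ∘ toℕ) ⟩
  ∑[ i < m ] f (toℕ (inject₁ i)) + f (toℕ (fromℕ m))
    ≡⟨ ≡.cong₂ _+_ (sum-cong-≗ {m} (≡.cong f ∘ toℕ-inject₁)) (≡.cong f (toℕ-fromℕ m)) ⟩
  ∑[ i < m ] f (toℕ i) + f m                        ≡⟨ +-comm _ (f m) ⟩
  f m + ∑[ i < m ] f (toℕ i)                        ∎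
  where open ≡-Reasoning

least-witness : ∀ {p} {P : Pred ℕ p} → Decidable P → ∀ {d} → P d →
                ∃ λ m → P m × (∀ {j} → j < m → ¬ P j)
least-witness {P = P} P? {d} Pd = descend d (<-wellFounded d) Pd
  where
  descend : ∀ d → Acc _<_ d → P d → ∃ λ m → P m × (∀ {j} → j < m → ¬ P j)
  descend d (acc smaller) Pd with any? {n = d} (P? ∘ toℕ)
  ... | yes (j , Pj) = descend (toℕ j) (smaller (toℕ<n j)) Pj
  ... | no  none     = d , Pd , λ j<d Pj →
    none (fromℕ< j<d , ≡.subst P (≡.sym (toℕ-fromℕ< j<d)) Pj)

prime∤⇒coprime : ∀ {p n} → Prime p → ¬ p ∣ n → Coprime p n
prime∤⇒coprime p-prime p∤n (d∣p , d∣n) with prime⇒irreducible p-prime d∣p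
... | inj₁ d≡1 = d≡1
... | inj₂ ≡.refl = contradiction d∣n p∤n

module GroupPowers {c ℓ} (G : Group c ℓ) where
  open Group G
  open import Algebra.Properties.Group G using (∙-cancelˡ; inverseʳ-unique; ⁻¹-involutive)
  open import Algebra.Properties.Monoid.Mult monoid
    using (×-congʳ; ×-homo-+; ×-homo-1; ×-assocˡ) renaming (_×_ to _·_)
  open import Function.Consequences.Setoid setoid setoid
    using (inverseᵇ⇒bijective; strictlyInverseˡ⇒inverseˡ; strictlyInverseʳ⇒inverseʳ)
  open import Relation.Binary.Reasoning.Setoid setoid

  infixr 8 _^_
  _^_ : Carrier → ℕ → Carrier
  x ^ k = k · x

  ^-congˡ : ∀ k {x y} → x ≈ y → x ^ k ≈ y ^ k
  ^-congˡ = ×-congʳ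

  ^-+ : ∀ x i j → x ^ (i + j) ≈ x ^ i ∙ x ^ j
  ^-+ = ×-homo-+

  ^-* : ∀ x i j → (x ^ i) ^ j ≈ x ^ (j * i)
  ^-* x i j = ×-assocˡ x j i

  ^-^-comm : ∀ x i j → (x ^ i) ^ j ≈ (x ^ j) ^ i
  ^-^-comm x i j = begin
    (x ^ i) ^ j  ≈⟨ ^-* x i j ⟩
    x ^ (j * i)  ≡⟨ ≡.cong (x ^_) (*-comm j i) ⟩
    x ^ (i * j)  ≈⟨ ^-* x j i ⟨
    (x ^ j) ^ i  ∎

  ε^ : ∀ k → ε ^ k ≈ ε
  ε^ zero    = refl
  ε^ (suc k) = trans (identityˡ _) (ε^ k)

  ^-multiple : ∀ {x n} → x ^ n ≈ ε → ∀ q → x ^ (q * n) ≈ ε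
  ^-multiple {x} {n} xⁿ≈ε q = begin
    x ^ (q * n)  ≈⟨ ^-* x n q ⟨
    (x ^ n) ^ q  ≈⟨ ^-congˡ q xⁿ≈ε ⟩
    ε ^ q        ≈⟨ ε^ q ⟩
    ε            ∎

  ^-cancel : ∀ x {i j} → i ≤ j → x ^ i ≈ x ^ j → x ^ (j ∸ i) ≈ ε
  ^-cancel x {i} {j} i≤j xⁱ≈xʲ = sym (∙-cancelˡ (x ^ i) _ _ (begin
    x ^ i ∙ ε            ≈⟨ identityʳ _ ⟩
    x ^ i                ≈⟨ xⁱ≈xʲ ⟩
    x ^ j                ≡⟨ ≡.cong (x ^_) (m+[n∸m]≡n i≤j) ⟨
    x ^ (i + (j ∸ i))    ≈⟨ ^-+ x i (j ∸ i) ⟩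
    x ^ i ∙ x ^ (j ∸ i)  ∎))

  IsPeriod : Carrier → ℕ → Set ℓ
  IsPeriod x d = 0 < d × x ^ d ≈ ε

  IsOrder : Carrier → ℕ → Set ℓ
  IsOrder x m = IsPeriod x m × (∀ {j} → j < m → ¬ IsPeriod x j)

  order⇒^-injective : ∀ {x m} → IsOrder x m → ∀ {i j} → i < m → j < m → x ^ i ≈ x ^ j → i ≡ j
  order⇒^-injective {x} (_ , minimal) {i} {j} i<m j<m xⁱ≈xʲ with <-cmp i j
  ... | tri< i<j _ _ = contradiction (m<n⇒0<n∸m i<j , ^-cancel x (<⇒≤ i<j) xⁱ≈xʲ)
                                     (minimal (≤-<-trans (m∸n≤m j i) j<m))
  ... | tri≈ _ i≡j _ = i≡j
  ... | tri> _ _ j<i = contradiction (m<n⇒0<n∸m j<i , ^-cancel x (<⇒≤ j<i) (sym xⁱ≈xʲ))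
                                     (minimal (≤-<-trans (m∸n≤m i j) i<m))

  ^-bijective : ∀ k e → (∀ x → (x ^ k) ^ e ≈ x) → IsBijectionOfG G (_^ k)
  ^-bijective k e root = ^-congˡ k , inverseᵇ⇒bijective
    ( strictlyInverseˡ⇒inverseˡ (^-congˡ k) (λ y → trans (^-^-comm y e k) (root y))
    , strictlyInverseʳ⇒inverseʳ (^-congˡ e) root)

  coprime⇒root : ∀ {n k} → (∀ x → x ^ n ≈ ε) → Coprime k n → ∃ λ e → ∀ x → (x ^ k) ^ e ≈ x
  coprime⇒root {n} {k} xⁿ≈ε k⊥n with coprime-Bézout k⊥n
  ... | Bézout.+- d t 1+tn≡dk = d , λ x → begin
    (x ^ k) ^ d        ≈⟨ ^-* x k d ⟩
    x ^ (d * k)        ≡⟨ ≡.cong (x ^_) 1+tn≡dk ⟨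
    x ∙ x ^ (t * n)    ≈⟨ ∙-congˡ (^-multiple (xⁿ≈ε x) t) ⟩
    x ∙ ε              ≈⟨ identityʳ x ⟩
    x                  ∎
  -- Here d k ≡ -1 (mod n), so x ^ (d k) is the inverse of x and (d k)² ≡ 1.
  ... | Bézout.-+ d t 1+dk≡tn = e * d , λ x → begin
    (x ^ k) ^ (e * d)  ≈⟨ ^-* x k (e * d) ⟩
    x ^ (e * d * k)    ≡⟨ ≡.cong (x ^_) (*-assoc e d k) ⟩
    x ^ (e * e)        ≈⟨ ^-* x e e ⟨
    (x ^ e) ^ e        ≈⟨ ^-congˡ e (x^e≈x⁻¹ x) ⟩
    (x ⁻¹) ^ e         ≈⟨ x^e≈x⁻¹ (x ⁻¹) ⟩
    x ⁻¹ ⁻¹            ≈⟨ ⁻¹-involutive x ⟩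
    x                  ∎
    where
    e = d * k
    x^e≈x⁻¹ : ∀ x → x ^ e ≈ x ⁻¹
    x^e≈x⁻¹ x = inverseʳ-unique x (x ^ e) (begin
      x ∙ x ^ e    ≡⟨ ≡.cong (x ^_) 1+dk≡tn ⟩
      x ^ (t * n)  ≈⟨ ^-multiple (xⁿ≈ε x) t ⟩
      ε            ∎)

  coprime⇒^-bijective : ∀ {n k} → (∀ x → x ^ n ≈ ε) → Coprime k n → IsBijectionOfG G (_^ k)
  coprime⇒^-bijective {k = k} xⁿ≈ε k⊥n with e , root ← coprime⇒root xⁿ≈ε k⊥n =
    ^-bijective k e root

  isBijectionOfG-resp : ∀ {f g} → (∀ x → f x ≈ g x) → IsBijectionOfG G g → IsBijectionOfG G f
  isBijectionOfG-resp f≈g (g-cong , g-injective , g-surjective) =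
    (λ x≈y → trans (f≈g _) (trans (g-cong x≈y) (sym (f≈g _)))) ,
    (λ fx≈fy → g-injective (trans (sym (f≈g _)) (trans fx≈fy (f≈g _)))) ,
    (λ y → map id (λ fz≈y z≈x → trans (f≈g _) (fz≈y z≈x)) (g-surjective y))

  id-isBijectionOfG : IsBijectionOfG G id
  id-isBijectionOfG = id , id , λ y → y , id

  squaring-colouring : IsBijectionOfG G (_^ 2) → IsBijectionOfG G (_^ 3) → Colourable G
  squaring-colouring square cube = (_^ 2) , square ,
    isBijectionOfG-resp x²∙x≈x³ cube ,
    isBijectionOfG-resp x⁻¹∙x²≈x id-isBijectionOfG ,
    isBijectionOfG-resp x⁻¹∙x²∙x≈x² square
    where
    x²∙x≈x³ : ∀ x → x ^ 2 ∙ x ≈ x ^ 3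
    x²∙x≈x³ x = sym (trans (^-+ x 2 1) (∙-congˡ (×-homo-1 x)))
    x⁻¹∙x²≈x : ∀ x → x ⁻¹ ∙ x ^ 2 ≈ x
    x⁻¹∙x²≈x x = begin
      x ⁻¹ ∙ (x ∙ (x ∙ ε))  ≈⟨ assoc _ _ _ ⟨
      (x ⁻¹ ∙ x) ∙ (x ∙ ε)  ≈⟨ ∙-congʳ (inverseˡ x) ⟩
      ε ∙ (x ∙ ε)           ≈⟨ identityˡ _ ⟩
      x ∙ ε                 ≈⟨ identityʳ x ⟩
      x                     ∎
    x⁻¹∙x²∙x≈x² : ∀ x → (x ⁻¹ ∙ x ^ 2) ∙ x ≈ x ^ 2
    x⁻¹∙x²∙x≈x² x = trans (∙-congʳ (x⁻¹∙x²≈x x)) (∙-congˡ (sym (identityʳ x)))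

module FiniteGroup {c ℓ} (G : Group c ℓ) {n} (card : HasOrder G n) where
  open Group G
  open GroupPowers G
  open import Algebra.Properties.Group G using (∙-cancelˡ; ∙-cancelʳ)
  open Bijection card using (to; strictlySurjective) renaming (injective to to-injective)
  private
    index : Injection setoid (≡.setoid (Fin n))
    index = Inverse⇒Injection (↔-sym (Bijection⇒Inverse card))
    module Index = Injection index

  infix 4 _≈?_
  _≈?_ : ∀ a b → Dec (a ≈ b)
  _≈?_ = inj⇒≟ index

  period : ∀ x → ∃ (IsPeriod x)
  period x with i , j , i<j , same ← pigeonhole (n<1+n n) (Index.to ∘ (x ^_) ∘ toℕ) =
    toℕ j ∸ toℕ i , m<n⇒0<n∸m i<j , ^-cancel x (<⇒≤ i<j) (Index.injective same)

  order : ∀ x → ∃ (IsOrder x)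
  order x = least-witness (λ j → (0 <? j) ×-dec (x ^ j ≈? ε)) (proj₂ (period x))

  δ : Carrier → Carrier → ℕ
  δ a b with a ≈? b
  ... | yes _ = 1
  ... | no  _ = 0

  δ-≈ : ∀ {a b} → a ≈ b → δ a b ≡ 1
  δ-≈ {a} {b} a≈b with a ≈? b
  ... | yes _   = ≡.refl
  ... | no  a≉b = contradiction a≈b a≉b

  δ-≉ : ∀ {a b} → ¬ a ≈ b → δ a b ≡ 0
  δ-≉ {a} {b} a≉b with a ≈? b
  ... | yes a≈b = contradiction a≈b a≉b
  ... | no  _   = ≡.refl

  δ-resp : ∀ {a b a′ b′} → (a ≈ b → a′ ≈ b′) → (a′ ≈ b′ → a ≈ b) → δ a b ≡ δ a′ b′
  δ-resp {a} {b} ⇒ ⇐ with a ≈? b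
  ... | yes a≈b = ≡.sym (δ-≈ (⇒ a≈b))
  ... | no  a≉b = ≡.sym (δ-≉ (a≉b ∘ ⇐))

  δ-congˡ : ∀ {a a′ b} → a ≈ a′ → δ a b ≡ δ a′ b
  δ-congˡ a≈a′ = δ-resp (trans (sym a≈a′)) (trans a≈a′)

  δ-congʳ : ∀ {a b b′} → b ≈ b′ → δ a b ≡ δ a b′
  δ-congʳ b≈b′ = δ-resp (λ a≈b → trans a≈b b≈b′) (λ a≈b′ → trans a≈b′ (sym b≈b′))

  δ-cancelˡ : ∀ x {a b} → δ (x ∙ a) (x ∙ b) ≡ δ a b
  δ-cancelˡ x = δ-resp (∙-cancelˡ x _ _) ∙-congˡ

  total : (Carrier → ℕ) → ℕ
  total w = ∑[ i < n ] w (to i)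

  total-δ : ∀ a → total (δ a) ≡ 1
  total-δ a with i , toᵢ≈a ← strictlySurjective a =
    ∑-indicator _ i (δ-≈ (sym toᵢ≈a))
      (λ j j≢i → δ-≉ (λ a≈toⱼ → j≢i (to-injective (trans (sym a≈toⱼ) (sym toᵢ≈a)))))

  module CyclicOrbits (x : Carrier) (m : ℕ) (x-order : IsOrder x (suc m)) where

    x^[1+m]≈ε : x ^ suc m ≈ ε
    x^[1+m]≈ε = proj₂ (proj₁ x-order)

    Invariant : (Carrier → ℕ) → Set (c ⊔ ℓ)
    Invariant w = (∀ {a b} → a ≈ b → w a ≡ w b) × (∀ g → w (x ∙ g) ≡ w g)

    invariant-powers : ∀ {w} → Invariant w → ∀ k h → w (x ^ k ∙ h) ≡ w h
    invariant-powers (w-cong , _)           zero    h = w-cong (identityˡ h)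
    invariant-powers inv@(w-cong , w-shift) (suc k) h = ≡.trans (w-cong (assoc x (x ^ k) h))
      (≡.trans (w-shift (x ^ k ∙ h)) (invariant-powers inv k h))

    orbit : Carrier → Carrier → ℕ
    orbit h g = ∑[ k < suc m ] δ (x ^ toℕ k ∙ h) g

    orbit-invariant : ∀ h → Invariant (orbit h)
    orbit-invariant h = (λ a≈b → sum-cong-≗ {suc m} (λ k → δ-congʳ {x ^ toℕ k ∙ h} a≈b)) , shift
      where
      open ≡-Reasoning
      shift : ∀ g → orbit h (x ∙ g) ≡ orbit h g
      shift g = begin
        orbit h (x ∙ g)
          ≡⟨⟩
        δ (ε ∙ h) (x ∙ g) + ∑[ k < m ] δ ((x ∙ x ^ toℕ k) ∙ h) (x ∙ g)
          ≡⟨ ≡.cong₂ _+_ (≡.trans (δ-congˡ ε∙h≈x∙xᵐ∙h) (δ-cancelˡ x))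
                         (sum-cong-≗ {m} (λ k → ≡.trans (δ-congˡ (assoc x (x ^ toℕ k) h)) (δ-cancelˡ x))) ⟩
        δ (x ^ m ∙ h) g + ∑[ k < m ] δ (x ^ toℕ k ∙ h) g
          ≡⟨ ∑-last m (λ k → δ (x ^ k ∙ h) g) ⟨
        orbit h g ∎
        where
        ε∙h≈x∙xᵐ∙h : ε ∙ h ≈ x ∙ (x ^ m ∙ h)
        ε∙h≈x∙xᵐ∙h = trans (∙-congʳ (sym x^[1+m]≈ε)) (assoc x (x ^ m) h)

    total-orbit : ∀ h → total (orbit h) ≡ suc m
    total-orbit h = begin
      ∑[ i < n ] ∑[ k < suc m ] δ (x ^ toℕ k ∙ h) (to i)
        ≡⟨ ∑-comm {n} {suc m} (λ i k → δ (x ^ toℕ k ∙ h) (to i)) ⟩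
      ∑[ k < suc m ] total (δ (x ^ toℕ k ∙ h))
        ≡⟨ sum-cong-≗ {suc m} (λ k → total-δ (x ^ toℕ k ∙ h)) ⟩
      ∑[ k < suc m ] 1
        ≡⟨ ∑-ones (suc m) ⟩
      suc m ∎
      where open ≡-Reasoning

    orbit-member : ∀ {h g} k → x ^ toℕ k ∙ h ≈ g → orbit h g ≡ 1
    orbit-member {h} {g} k xᵏh≈g = ∑-indicator _ k (δ-≈ xᵏh≈g) λ j j≢k → δ-≉ λ xʲh≈g →
      j≢k (toℕ-injective (order⇒^-injective x-order (toℕ<n j) (toℕ<n k)
        (∙-cancelʳ h _ _ (trans xʲh≈g (sym xᵏh≈g)))))

    orbit-nonmember : ∀ {h g} → (∀ k → ¬ x ^ toℕ k ∙ h ≈ g) → orbit h g ≡ 0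
    orbit-nonmember {h} {g} ∉ = ∑-zero {suc m} (λ k → δ (x ^ toℕ k ∙ h) g) (λ k → δ-≉ (∉ k))

    orbit≤ : ∀ {w} → Invariant w → ∀ {h} → w h ≢ 0 → ∀ g → orbit h g ≤ w g
    orbit≤ {w} inv@(w-cong , _) {h} wh≢0 g with any? {suc m} (λ k → x ^ toℕ k ∙ h ≈? g)
    ... | no  ∉ = ≡.subst (_≤ w g) (≡.sym (orbit-nonmember (λ k xᵏh≈g → ∉ (k , xᵏh≈g)))) z≤n
    ... | yes (k , xᵏh≈g) = begin
      orbit h g          ≡⟨ orbit-member k xᵏh≈g ⟩
      1                  ≤⟨ n≢0⇒n>0 wh≢0 ⟩
      w h                ≡⟨ invariant-powers inv (toℕ k) h ⟨
      w (x ^ toℕ k ∙ h)  ≡⟨ w-cong xᵏh≈g ⟩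
      w g                ∎
      where open ≤-Reasoning

    ∸-orbit-invariant : ∀ {w} → Invariant w → ∀ h → Invariant (λ g → w g ∸ orbit h g)
    ∸-orbit-invariant (w-cong , w-shift) h =
      (λ a≈b → ≡.cong₂ _∸_ (w-cong a≈b) (proj₁ (orbit-invariant h) a≈b)) ,
      (λ g → ≡.cong₂ _∸_ (w-shift g) (proj₂ (orbit-invariant h) g))

    total-∸-orbit : ∀ {w} → Invariant w → ∀ {h} → w h ≢ 0 →
                    total (λ g → w g ∸ orbit h g) + suc m ≡ total w
    total-∸-orbit {w} inv {h} wh≢0 = begin
      total w′ + suc m                 ≡⟨ ≡.cong (total w′ +_) (total-orbit h) ⟨
      total w′ + total (orbit h)       ≡⟨ ∑-distrib-+ (w′ ∘ to) (orbit h ∘ to) ⟨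
      total (λ g → w′ g + orbit h g)   ≡⟨ sum-cong-≗ (λ i → m∸n+n≡m (orbit≤ inv wh≢0 (to i))) ⟩
      total w                          ∎
      where
      open ≡-Reasoning
      w′ = λ g → w g ∸ orbit h g

    order∣total : ∀ {w} → Invariant w → suc m ∣ total w
    order∣total {w} inv = peel w inv (<-wellFounded (total w))
      where
      peel : ∀ w → Invariant w → Acc _<_ (total w) → suc m ∣ total w
      peel w inv (acc smaller) with total w ≟ 0
      ... | yes ∑w≡0 = ≡.subst (suc m ∣_) (≡.sym ∑w≡0) (suc m ∣0)
      ... | no  ∑w≢0 with i , wᵢ≢0 ← ∑-nonzero _ ∑w≢0 =
        ≡.subst (suc m ∣_) ∑w′+m≡∑w
          (∣m∣n⇒∣m+n (peel w′ (∸-orbit-invariant inv h) (smaller ∑w′<∑w)) ∣-refl)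
        where
        h = to i
        w′ = λ g → w g ∸ orbit h g
        ∑w′+m≡∑w = total-∸-orbit inv wᵢ≢0
        ∑w′<∑w = ≡.subst (total w′ <_) ∑w′+m≡∑w (m<m+n (total w′) z<s)

  order∣n : ∀ {x m} → IsOrder x (suc m) → suc m ∣ n
  order∣n {x} {m} x-order = ≡.subst (suc m ∣_) (∑-ones n)
    (order∣total {λ _ → 1} ((λ _ → ≡.refl) , (λ _ → ≡.refl)))
    where open CyclicOrbits x m x-order

  x^n≈ε : ∀ x → x ^ n ≈ ε
  x^n≈ε x with order x
  ... | zero  , (() , _) , _
  ... | suc m , x-order@((_ , x^[1+m]≈ε) , _) with divides q n≡q*[1+m] ← order∣n x-order =
    trans (reflexive (≡.cong (x ^_) n≡q*[1+m])) (^-multiple x^[1+m]≈ε q)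

corollary1p3 : {c ℓ : Level} (G : Group c ℓ) (n : ℕ) → HasOrder G n
               → ¬ (2 ∣ n) → ¬ (3 ∣ n) → Colourable G
corollary1p3 G n card 2∤n 3∤n =
  squaring-colouring (prime-power-bijective prime[2] 2∤n)
                     (prime-power-bijective (from-yes (prime? 3)) 3∤n)
  where
  open GroupPowers G
  prime-power-bijective : ∀ {p} → Prime p → ¬ p ∣ n → IsBijectionOfG G (_^ p)
  prime-power-bijective p-prime p∤n =
    coprime⇒^-bijective (FiniteGroup.x^n≈ε G card) (prime∤⇒coprime p-prime p∤n)
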